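{- Let $N$ be an even positive integer, let $L$ be a positive integer with $L \le N$, and let $h_0, h_1$ be real filters of length $L$, i.e. $h_c = (h_c(0), \dots, h_c(L-1)) \in \mathbb{R}^L$ for $c \in \{0,1\}$. Define the $N \times N$ real matrix $\mathbf{T}_s$ as follows. For $m = 0, 1, \dots, N/2 - 1$ and $c \in \{0,1\}$, row number $2m + 1 + c$ of $\mathbf{T}_s$ has entry $h_c(L-1-\ell)$ in column $((2m + \ell) \bmod N) + 1$ for $\ell = 0, \dots, L-1$, and zeros in all other columns. Thus consecutive pairs of rows are shifted by two columns, with indices taken modulo $N$. Assume $\mathbf{T}_s$ is invertible. Define the interleaver $\Pi : \{1, \dots, N\} \to \{1, \dots, N\}$ by $\Pi(i) = ((i - 1 + N/2) \bmod N) + 1$. Let $\mathbf{T}_\Pi$ be the $N \times N$ matrix whose $i$-th row is row $\Pi(i)$ of $\mathbf{T}_s$. Let $$\mathbf{T} = \begin{pmatrix} \mathbf{T}_s \\ \mathbf{T}_\Pi \end{pmatrix} \in \mathbb{R}^{2N \times N},$$ and for an information vector $x \in \mathbb{R}^N$ let $y = \mathbf{T}x = (y_1, \dots, y_{2N})^t$. Consider erasure patterns of the following form. There is a set of consecutive indices $S = \{a, a+1, \dots, a+m-1\} \subseteq \{1, \dots, N\}$, and exactly the entries $y_i$ and $y_{i+N}$ for $i \in S$ are erased. The total number of erased entries is therefore $2m$. Then: (i) If $2m \le N$, the vector $x$ is uniquely determined by the non-erased entries of $y$. That is, for any $x, x' \in \mathbb{R}^N$, if $\mathbf{T}x$ and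 $\mathbf{T}x'$ agree on all non-erased coordinates, then $x = x'$. (ii) If the number of erased entries exceeds $N$, then $x$ is not uniquely determined by the non-erased entries of $y$. So this scheme recovers from up to $N$ such consecutive erasures and no more.
   Context: This is a rate-$1/2$ "turbo-like" encoder over the reals. The data block $x$ of length $N$ (the interleaver size) is encoded by a two-channel critically sampled filter bank with analysis filters $h_0, h_1$; this is the matrix $\mathbf{T}_s$. The same block is also encoded with the rows of $\mathbf{T}_s$ interleaved by $\Pi$; this is the matrix $\mathbf{T}_\Pi$. The two outputs are stacked into a vector of length $2N$. The channel only erases entries, and the erasure of $y_i$ is always accompanied by the erasure of $y_{i+N}$. The filter bank is critically sampled with perfect reconstruction, so $\mathbf{T}_s$ is an invertible square matrix. -}

module Defs where

open import Level using (Level; suc; _⊔_)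
open import Data.Nat as ℕ using (ℕ)
open import Data.Nat.DivMod using (_%_; _/_; m%n<n)
open import Data.Fin as Fin using (Fin; toℕ; fromℕ<; _↑ˡ_; _↑ʳ_; splitAt)
import Data.Nat.Properties as ℕP
open import Data.Sum using (_⊎_; [_,_])
open import Data.Product using (Σ; ∃; _×_)
open import Relation.Nullary using (¬_; yes; no)
open import Relation.Binary.PropositionalEquality using (_≡_)
open import Algebra.Bundles using (CommutativeRing)
import Algebra.Properties.Monoid.Sum as MonoidSum

record Field (c ℓ : Level) : Set (suc (c ⊔ ℓ)) where
  field
    commRing  : CommutativeRing c ℓ
  open CommutativeRing commRing public
  field
    1≉0       : ¬ (1# ≈ 0#)
    inverse   : ∀ x → ¬ (x ≈ 0#) → ∃ λ y → (x * y) ≈ 1#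

module LinAlg {c ℓ} (F : Field c ℓ) where
  open Field F
  open MonoidSum +-monoid using (sum)

  Matrix : ℕ → ℕ → Set c
  Matrix m n = Fin m → Fin n → Carrier

  Vector : ℕ → Set c
  Vector n = Fin n → Carrier

  _·_ : ∀ {m n} → Matrix m n → Vector n → Vector m
  (A · x) i = sum (λ j → A i j * x j)

  _⊗_ : ∀ {m n p} → Matrix m n → Matrix n p → Matrix m p
  (A ⊗ B) i k = sum (λ j → A i j * B j k)

  identity : ∀ {n} → Matrix n n
  identity i j with toℕ i ℕ.≟ toℕ j
  ... | yes _ = 1#
  ... | no  _ = 0#

  _≈ᴹ_ : ∀ {m n} → Matrix m n → Matrix m n → Set ℓ
  A ≈ᴹ B = ∀ i j → A i j ≈ B i j

  Invertible : ∀ {n} → Matrix n n → Set (c ⊔ ℓ)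
  Invertible {n} A = ∃ λ (B : Matrix n n) → ((B ⊗ A) ≈ᴹ identity) × ((A ⊗ B) ≈ᴹ identity)

  -- Setting of the paper (0-based indices).
  -- Row r = 2m + c of T_s has entry h_c(L-1-ℓ) in column (2m+ℓ) mod N,
  -- ℓ = 0..L-1, zero elsewhere.  For column j we compute the unique
  -- candidate ℓ = (j + N - 2m) mod N (unique since L ≤ N).
  module Encoder (k : ℕ) .{{_ : ℕ.NonZero k}} (L : ℕ) (h : Fin 2 → Fin L → Carrier) where

    N : ℕ
    N = 2 ℕ.* k

    instance
      N-nz : ℕ.NonZero N
      N-nz = ℕP.m*n≢0 2 k

    Ts : Matrix N N
    Ts r j with ((toℕ j ℕ.+ N ℕ.∸ 2 ℕ.* (toℕ r / 2)) % N) ℕ.<? L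
    ... | yes d<L = h (fromℕ< (m%n<n (toℕ r) 2))
                      (Fin.opposite (fromℕ< d<L))
    ... | no  _   = 0#

    Π : Fin N → Fin N
    Π i = fromℕ< (m%n<n (toℕ i ℕ.+ k) N)

    TΠ : Matrix N N
    TΠ i j = Ts (Π i) j

    T : Matrix (N ℕ.+ N) N
    T p j = [ (λ i → Ts i j) , (λ i → TΠ i j) ] (splitAt N p)

    InS : ℕ → ℕ → Fin N → Set
    InS a m i = a ℕ.≤ toℕ i × toℕ i ℕ.< a ℕ.+ m

    Erased : ℕ → ℕ → Fin (N ℕ.+ N) → Set
    Erased a m p = ∃ λ (i : Fin N) → InS a m i × ((p ≡ i ↑ˡ N) ⊎ (p ≡ N ↑ʳ i))

    AgreeOffErasures : ℕ → ℕ → Vector N → Vector N → Set ℓ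
    AgreeOffErasures a m x x' = ∀ p → ¬ Erased a m p → (T · x) p ≈ (T · x') p

{-# OPTIONS --safe #-}
-- Only two features of the encoder matter: T_s is invertible, and the bottom
-- half of T is T_s with rows permuted by the half-turn Π r = r + N/2 mod N,
-- an involution.  So row r of T_s can be read off the received word iff
-- r ∉ S or Π r ∉ S.
-- If m ≤ N/2, the window S never contains both r and r ± N/2, so all of
-- T_s x is read off and x is recovered with a left inverse of T_s.
-- If m > N/2, S contains both a and Π a = a + N/2; the column a + N/2 of a
-- right inverse of T_s is a nonzero x whose image vanishes off the erasures.
module Submission where

open import Defs
open import Data.Nat using (ℕ; _+_; _*_; _≤_; _<_; NonZero)
open import Data.Fin using (Fin)
open import Data.Product using (∃; _×_)
open import Relation.Nullary using (¬_)

import Data.Nat as ℕ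
import Data.Nat.Properties as ℕP
open import Data.Nat.DivMod using (_%_; [m+n]%n≡m%n; m<n⇒m%n≡m)
open import Data.Fin using (toℕ; fromℕ<; _↑ˡ_; _↑ʳ_; splitAt; punchIn)
import Data.Fin.Properties as FinP
open import Data.Sum using (inj₁; inj₂; _⊎_; [_,_])
open import Data.Product using (_,_; proj₁; proj₂)
open import Function using (_∘_)
open import Data.Empty using (⊥-elim)
open import Relation.Nullary using (Dec; yes; no)
open import Relation.Nullary.Decidable using (_×-dec_)
open import Relation.Binary.PropositionalEquality as ≡ using (_≡_; _≢_)
import Algebra.Properties.Semiring.Sum as SemiringSum
import Relation.Binary.Reasoning.Setoid as SetoidReasoning

↑ˡ≢↑ʳ : ∀ {m n} (i : Fin m) (j : Fin n) → i ↑ˡ n ≢ m ↑ʳ j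
↑ˡ≢↑ʳ {m} {n} i j e with ≡.trans (≡.sym (FinP.splitAt-↑ˡ m i n))
                                 (≡.trans (≡.cong (splitAt m) e) (FinP.splitAt-↑ʳ m n j))
... | ()

data SplitView (m n : ℕ) : Fin (m + n) → Set where
  left  : (i : Fin m) → SplitView m n (i ↑ˡ n)
  right : (j : Fin n) → SplitView m n (m ↑ʳ j)

splitView : ∀ m {n} (p : Fin (m + n)) → SplitView m n p
splitView m p with splitAt m p in eq
... | inj₁ i = ≡.subst (SplitView m _) (FinP.splitAt⁻¹-↑ˡ eq) (left i)
... | inj₂ j = ≡.subst (SplitView m _) (FinP.splitAt⁻¹-↑ʳ eq) (right j)

module MatrixProperties {c ℓ} (F : Field c ℓ) where
  open Field F renaming (_+_ to _⊕_; _*_ to _⊛_)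
  open LinAlg F
  open SemiringSum semiring
    using (sum; sum-cong-≋; sum-replicate-zero; sum-remove; ∑-comm; *-distribˡ-sum; *-distribʳ-sum)
  open SetoidReasoning setoid

  identity-diag : ∀ {n} (i : Fin n) → identity i i ≈ 1#
  identity-diag i with toℕ i ℕ.≟ toℕ i
  ... | yes _ = refl
  ... | no i≢i = ⊥-elim (i≢i ≡.refl)

  identity-offdiag : ∀ {n} {i j : Fin n} → i ≢ j → identity i j ≈ 0#
  identity-offdiag {i = i} {j} i≢j with toℕ i ℕ.≟ toℕ j
  ... | yes i≡j = ⊥-elim (i≢j (FinP.toℕ-injective i≡j))
  ... | no _ = refl

  sum-zero : ∀ {n} {f : Vector n} → (∀ i → f i ≈ 0#) → sum f ≈ 0#
  sum-zero {n} f≈0 = trans (sum-cong-≋ f≈0) (sum-replicate-zero n)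

  ·-congˡ : ∀ {m n} (A : Matrix m n) {x y : Vector n} → (∀ j → x j ≈ y j) →
            ∀ i → (A · x) i ≈ (A · y) i
  ·-congˡ A x≈y i = sum-cong-≋ (λ j → *-congˡ (x≈y j))

  ·-congʳ : ∀ {m n} {A B : Matrix m n} → A ≈ᴹ B → ∀ (x : Vector n) i → (A · x) i ≈ (B · x) i
  ·-congʳ A≈B x i = sum-cong-≋ (λ j → *-congʳ (A≈B i j))

  ·-zeroʳ : ∀ {m n} (A : Matrix m n) i → (A · λ _ → 0#) i ≈ 0#
  ·-zeroʳ A i = sum-zero (λ j → zeroʳ (A i j))

  identity-· : ∀ {n} (x : Vector n) i → (identity · x) i ≈ x i
  identity-· {ℕ.suc n} x i = begin
    (identity · x) i
      ≈⟨ sum-remove {i = i} (λ r → identity i r ⊛ x r) ⟩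
    identity i i ⊛ x i ⊕ sum (λ r → identity i (punchIn i r) ⊛ x (punchIn i r))
      ≈⟨ +-cong (*-congʳ (identity-diag i)) (sum-zero off-diagonal) ⟩
    1# ⊛ x i ⊕ 0#
      ≈⟨ +-identityʳ _ ⟩
    1# ⊛ x i
      ≈⟨ *-identityˡ _ ⟩
    x i ∎
    where
    off-diagonal : ∀ r → identity i (punchIn i r) ⊛ x (punchIn i r) ≈ 0#
    off-diagonal r = trans (*-congʳ (identity-offdiag (≡.≢-sym (FinP.punchInᵢ≢i i r)))) (zeroˡ _)

  ⊗-· : ∀ {m n p} (A : Matrix m n) (B : Matrix n p) (x : Vector p) i →
        ((A ⊗ B) · x) i ≈ (A · (B · x)) i
  ⊗-· A B x i = begin
    sum (λ r → sum (λ j → A i j ⊛ B j r) ⊛ x r)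
      ≈⟨ sum-cong-≋ (λ r → *-distribʳ-sum (x r) (λ j → A i j ⊛ B j r)) ⟩
    sum (λ r → sum (λ j → A i j ⊛ B j r ⊛ x r))
      ≈⟨ ∑-comm (λ r j → A i j ⊛ B j r ⊛ x r) ⟩
    sum (λ j → sum (λ r → A i j ⊛ B j r ⊛ x r))
      ≈⟨ sum-cong-≋ (λ j → sum-cong-≋ (λ r → *-assoc (A i j) (B j r) (x r))) ⟩
    sum (λ j → sum (λ r → A i j ⊛ (B j r ⊛ x r)))
      ≈⟨ sum-cong-≋ (λ j → sym (*-distribˡ-sum (A i j) (λ r → B j r ⊛ x r))) ⟩
    sum (λ j → A i j ⊛ (B · x) j) ∎

  left-inverse⇒injective : ∀ {m n} {A : Matrix m n} {B : Matrix n m} → (B ⊗ A) ≈ᴹ identity →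
                           ∀ {x y : Vector n} → (∀ i → (A · x) i ≈ (A · y) i) → ∀ j → x j ≈ y j
  left-inverse⇒injective {A = A} {B} BA≈I {x} {y} Ax≈Ay j = begin
    x j                  ≈⟨ recover x ⟨
    (B · (A · x)) j      ≈⟨ ·-congˡ B Ax≈Ay j ⟩
    (B · (A · y)) j      ≈⟨ recover y ⟩
    y j                  ∎
    where
    recover : ∀ z → (B · (A · z)) j ≈ z j
    recover z = begin
      (B · (A · z)) j    ≈⟨ ⊗-· B A z j ⟨
      ((B ⊗ A) · z) j    ≈⟨ ·-congʳ BA≈I z j ⟩
      (identity · z) j   ≈⟨ identity-· z j ⟩
      z j                ∎

  right-inverse-column-nonzero : ∀ {m n} {A : Matrix m n} {B : Matrix n m} → (A ⊗ B) ≈ᴹ identity →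
                                 ∀ r → ¬ (∀ j → B j r ≈ 0#)
  right-inverse-column-nonzero {A = A} {B} AB≈I r column≈0 = 1≉0 (begin
    1#                    ≈⟨ identity-diag r ⟨
    identity r r          ≈⟨ AB≈I r r ⟨
    (A · λ j → B j r) r   ≈⟨ ·-congˡ A column≈0 r ⟩
    (A · λ _ → 0#) r      ≈⟨ ·-zeroʳ A r ⟩
    0#                    ∎)

module HalfTurnEncoder {c ℓ} (F : Field c ℓ) (k : ℕ) .{{_ : NonZero k}} (L : ℕ)
                       (h : Fin 2 → Fin L → Field.Carrier F) where
  open Field F using (_≈_; 0#; trans; sym)
  open LinAlg F
  open Encoder k L h
  open MatrixProperties F

  N≡k+k : N ≡ k + k
  N≡k+k = ≡.cong (k +_) (ℕP.+-identityʳ k)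

  HalfApart : ℕ → ℕ → Set
  HalfApart x y = x + k ≡ y ⊎ y + k ≡ x

  HalfApart-sym : ∀ {x y} → HalfApart x y → HalfApart y x
  HalfApart-sym (inj₁ e) = inj₂ e
  HalfApart-sym (inj₂ e) = inj₁ e

  HalfApart⇒Π : ∀ {i j} → HalfApart (toℕ i) (toℕ j) → Π i ≡ j
  HalfApart⇒Π {i} {j} apart = FinP.toℕ-injective (≡.trans (FinP.toℕ-fromℕ< _) (reduce apart))
    where
    open ≡.≡-Reasoning
    reduce : HalfApart (toℕ i) (toℕ j) → (toℕ i + k) % N ≡ toℕ j
    reduce (inj₁ i+k≡j) = ≡.trans (≡.cong (_% N) i+k≡j) (m<n⇒m%n≡m (FinP.toℕ<n j))
    reduce (inj₂ j+k≡i) = begin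
      (toℕ i + k) % N         ≡⟨ ≡.cong (λ v → (v + k) % N) j+k≡i ⟨
      (toℕ j + k + k) % N     ≡⟨ ≡.cong (_% N) (≡.trans (ℕP.+-assoc (toℕ j) k k)
                                                        (≡.cong (toℕ j +_) (≡.sym N≡k+k))) ⟩
      (toℕ j + N) % N         ≡⟨ [m+n]%n≡m%n (toℕ j) N ⟩
      toℕ j % N               ≡⟨ m<n⇒m%n≡m (FinP.toℕ<n j) ⟩
      toℕ j                   ∎

  Π-HalfApart : ∀ i → HalfApart (toℕ i) (toℕ (Π i))
  Π-HalfApart i with toℕ i ℕ.<? k
  ... | yes i<k = inj₁ (≡.trans i+k≡j (≡.cong toℕ (≡.sym (HalfApart⇒Π (inj₁ i+k≡j)))))
    where
    i+k<N : toℕ i + k < N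
    i+k<N = ≡.subst (toℕ i + k <_) (≡.sym N≡k+k) (ℕP.+-monoˡ-< k i<k)
    i+k≡j : toℕ i + k ≡ toℕ (fromℕ< i+k<N)
    i+k≡j = ≡.sym (FinP.toℕ-fromℕ< i+k<N)
  ... | no i≮k =
    inj₂ (≡.trans (≡.cong (λ v → toℕ v + k) (HalfApart⇒Π (inj₂ j+k≡i))) j+k≡i)
    where
    i∸k<N : toℕ i ℕ.∸ k < N
    i∸k<N = ℕP.≤-<-trans (ℕP.m∸n≤m (toℕ i) k) (FinP.toℕ<n i)
    j+k≡i : toℕ (fromℕ< i∸k<N) + k ≡ toℕ i
    j+k≡i = ≡.trans (≡.cong (_+ k) (FinP.toℕ-fromℕ< i∸k<N)) (ℕP.m∸n+n≡m (ℕP.≮⇒≥ i≮k))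

  Π-involutive : ∀ i → Π (Π i) ≡ i
  Π-involutive i = HalfApart⇒Π (HalfApart-sym (Π-HalfApart i))

  InS? : ∀ a m i → Dec (InS a m i)
  InS? a m i = (a ℕ.≤? toℕ i) ×-dec (toℕ i ℕ.<? a + m)

  short-window-not-HalfApart : ∀ {a m i j} → m ≤ k → InS a m i → InS a m j →
                               ¬ HalfApart (toℕ i) (toℕ j)
  short-window-not-HalfApart {a} {m} m≤k (a≤i , _) (_ , j<a+m) (inj₁ i+k≡j) =
    ℕP.<⇒≱ j<a+m (≡.subst (a + m ≤_) i+k≡j (ℕP.+-mono-≤ a≤i m≤k))
  short-window-not-HalfApart m≤k i∈S j∈S (inj₂ j+k≡i) =
    short-window-not-HalfApart m≤k j∈S i∈S (inj₁ j+k≡i)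

  Erased-top⇒InS : ∀ {a m i} → Erased a m (i ↑ˡ N) → InS a m i
  Erased-top⇒InS {a} {m} {i} (i′ , i′∈S , inj₁ e) =
    ≡.subst (InS a m) (FinP.↑ˡ-injective N i′ i (≡.sym e)) i′∈S
  Erased-top⇒InS (i′ , _ , inj₂ e) = ⊥-elim (↑ˡ≢↑ʳ _ i′ e)

  Erased-bottom⇒InS : ∀ {a m i} → Erased a m (N ↑ʳ i) → InS a m i
  Erased-bottom⇒InS (i′ , _ , inj₁ e) = ⊥-elim (↑ˡ≢↑ʳ i′ _ (≡.sym e))
  Erased-bottom⇒InS {a} {m} {i} (i′ , i′∈S , inj₂ e) =
    ≡.subst (InS a m) (FinP.↑ʳ-injective N i′ i (≡.sym e)) i′∈S

  T-top : ∀ (x : Vector N) i → (T · x) (i ↑ˡ N) ≡ (Ts · x) i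
  T-top x i rewrite FinP.splitAt-↑ˡ N i N = ≡.refl

  T-bottom : ∀ (x : Vector N) i → (T · x) (N ↑ʳ i) ≡ (Ts · x) (Π i)
  T-bottom x i rewrite FinP.splitAt-↑ʳ N N i = ≡.refl

  Observed : ℕ → ℕ → Fin N → Set
  Observed a m r = ¬ InS a m r ⊎ ¬ InS a m (Π r)

  agree⇒observed-rows-agree : ∀ {a m x y} → AgreeOffErasures a m x y →
                              ∀ {r} → Observed a m r → (Ts · x) r ≈ (Ts · y) r
  agree⇒observed-rows-agree {x = x} {y} agree {r} (inj₁ r∉S) =
    ≡.subst₂ _≈_ (T-top x r) (T-top y r) (agree (r ↑ˡ N) (r∉S ∘ Erased-top⇒InS))
  agree⇒observed-rows-agree {x = x} {y} agree {r} (inj₂ Πr∉S) =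
    ≡.subst₂ _≈_ (≡.trans (T-bottom x (Π r)) (≡.cong (Ts · x) (Π-involutive r)))
                 (≡.trans (T-bottom y (Π r)) (≡.cong (Ts · y) (Π-involutive r)))
                 (agree (N ↑ʳ Π r) (Πr∉S ∘ Erased-bottom⇒InS))

  observed-rows-agree⇒agree : ∀ {a m x y} → (∀ r → Observed a m r → (Ts · x) r ≈ (Ts · y) r) →
                              AgreeOffErasures a m x y
  observed-rows-agree⇒agree {x = x} {y} rows p not-erased with splitView N p
  ... | left i = ≡.subst₂ _≈_ (≡.sym (T-top x i)) (≡.sym (T-top y i))
                   (rows i (inj₁ (λ i∈S → not-erased (i , i∈S , inj₁ ≡.refl))))
  ... | right i = ≡.subst₂ _≈_ (≡.sym (T-bottom x i)) (≡.sym (T-bottom y i))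
                    (rows (Π i) (inj₂ (λ ΠΠi∈S → not-erased
                      (i , ≡.subst (InS _ _) (Π-involutive i) ΠΠi∈S , inj₂ ≡.refl))))

  short-window⇒all-rows-observed : ∀ {a m} → m ≤ k → ∀ r → Observed a m r
  short-window⇒all-rows-observed {a} {m} m≤k r with InS? a m r
  ... | yes r∈S = inj₂ (λ Πr∈S → short-window-not-HalfApart m≤k r∈S Πr∈S (Π-HalfApart r))
  ... | no r∉S = inj₁ r∉S

  long-window⇒row-unobserved : ∀ {a m} → k < m → a + m ≤ N → ∃ λ r → ¬ Observed a m r
  long-window⇒row-unobserved {a} {m} k<m a+m≤N =
    middle , [ (λ middle∉S → middle∉S middle∈S)
             , (λ Πmiddle∉S → Πmiddle∉S (≡.subst (InS a m) (≡.sym Π-middle) start∈S)) ]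
    where
    a+k<N : a + k < N
    a+k<N = ℕP.<-≤-trans (ℕP.+-monoʳ-< a k<m) a+m≤N
    a<N : a < N
    a<N = ℕP.≤-<-trans (ℕP.m≤m+n a k) a+k<N
    middle start : Fin N
    middle = fromℕ< a+k<N
    start = fromℕ< a<N
    middle∈S : InS a m middle
    middle∈S rewrite FinP.toℕ-fromℕ< a+k<N = ℕP.m≤m+n a k , ℕP.+-monoʳ-< a k<m
    start∈S : InS a m start
    start∈S rewrite FinP.toℕ-fromℕ< a<N = ℕP.≤-refl , ℕP.m<m+n a (ℕP.≤-<-trans ℕ.z≤n k<m)
    Π-middle : Π middle ≡ start
    Π-middle = HalfApart⇒Π (inj₂ (≡.trans (≡.cong (_+ k) (FinP.toℕ-fromℕ< a<N))
                                          (≡.sym (FinP.toℕ-fromℕ< a+k<N))))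

  erasures≤N⇒recoverable : Invertible Ts → ∀ {a m} → 2 * m ≤ N →
             ∀ x y → AgreeOffErasures a m x y → ∀ j → x j ≈ y j
  erasures≤N⇒recoverable (_ , left-inverse , _) 2m≤N x y agree =
    left-inverse⇒injective left-inverse
      (λ r → agree⇒observed-rows-agree agree
               (short-window⇒all-rows-observed (ℕP.*-cancelˡ-≤ 2 2m≤N) r))

  erasures>N⇒ambiguous : Invertible Ts → ∀ {a m} → a + m ≤ N → N < 2 * m →
              ∃ λ (x : Vector N) → ∃ λ (y : Vector N) →
                AgreeOffErasures a m x y × ¬ (∀ j → x j ≈ y j)
  erasures>N⇒ambiguous (B , _ , right-inverse) {a} {m} a+m≤N N<2m =
    column , 0⃗ , observed-rows-agree⇒agree rows-agree , right-inverse-column-nonzero right-inverse r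
    where
    unobserved = long-window⇒row-unobserved (ℕP.*-cancelˡ-< 2 k m N<2m) a+m≤N
    r = proj₁ unobserved
    column 0⃗ : Vector N
    column j = B j r
    0⃗ _ = 0#
    rows-agree : ∀ r′ → Observed a m r′ → (Ts · column) r′ ≈ (Ts · 0⃗) r′
    rows-agree r′ observed =
      trans (right-inverse r′ r) (trans (identity-offdiag r′≢r) (sym (·-zeroʳ Ts r′)))
      where
      r′≢r : r′ ≢ r
      r′≢r ≡.refl = proj₂ unobserved observed

theorem1 : ∀ {c ℓ} (F : Field c ℓ) → let open LinAlg F in
    (k : ℕ) .{{_ : NonZero k}} (L : ℕ) → 1 ≤ L → L ≤ 2 * k →
    (h : Fin 2 → Fin L → Field.Carrier F) → let open Encoder k L h in
    Invertible Ts →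
    (a m : ℕ) → a + m ≤ N →
    ((2 * m ≤ N →
        ∀ (x x' : Vector N) → AgreeOffErasures a m x x' →
          ∀ j → Field._≈_ F (x j) (x' j))
     × (N < 2 * m →
        ∃ λ (x : Vector N) → ∃ λ (x' : Vector N) →
          AgreeOffErasures a m x x' × ¬ (∀ j → Field._≈_ F (x j) (x' j))))
theorem1 F k L _ _ h Ts-invertible a m a+m≤N =
  erasures≤N⇒recoverable Ts-invertible {a} {m} , erasures>N⇒ambiguous Ts-invertible a+m≤N
  where open HalfTurnEncoder F k L h
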